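{- Let $m \geq 1$ be an integer and let $a_m = \nu_2(m(m+1))$. Then \[ m \equiv C(m) \equiv C^2(m) \equiv \cdots \equiv C^{a_m - 1}(m) \not\equiv C^{a_m}(m) \pmod 2, \] i.e. $a_m$ is the first time at which the orbit $m, C(m), C^2(m), \dots$ changes parity.
   Context: $\nu_2$ denotes the $2$-adic valuation. The Collatz map $C:\mathbb{N}\to\mathbb{N}$ is $C(i) = i/2$ if $i$ is even and $C(i) = (3i+1)/2$ if $i$ is odd; $C^k$ denotes its $k$-fold iterate. (In the paper, $a_m$ is also identified with $\nu_2(A_{1,m}) - 1$ for a certain integer sequence $A_{1,m}$.) -}

module Defs where

open import Data.Nat using (ℕ; zero; suc; _+_; _*_; _%_; _/_)
open import Data.Bool using (Bool; true; false; if_then_else_)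
open import Data.Nat.Properties using (_≟_)
open import Relation.Nullary.Decidable using (⌊_⌋)

C : ℕ → ℕ
C i = if ⌊ i % 2 ≟ 0 ⌋ then i / 2 else (3 * i + 1) / 2

iterC : ℕ → ℕ → ℕ
iterC zero    i = i
iterC (suc k) i = C (iterC k i)

-- 2-adic valuation with fuel; ν₂ n uses fuel n, which suffices for n ≥ 1
-- (since ν₂ n ≤ n); by convention ν₂ 0 = 0 (never used below).
ν₂-fuel : ℕ → ℕ → ℕ
ν₂-fuel zero    n = 0
ν₂-fuel (suc f) n =
  if ⌊ n ≟ 0 ⌋ then 0
  else (if ⌊ n % 2 ≟ 0 ⌋ then suc (ν₂-fuel f (n / 2)) else 0)

ν₂ : ℕ → ℕ
ν₂ n = ν₂-fuel n n

-- Write m(m+1) = 2^a u with u odd; one of m, m+1 is odd, so 2^a u is the even one of them.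
-- If m = 2^a u, halving gives C^k m = 2^(a-k) u: the orbit is even for k < a and reaches
-- the odd number u at k = a.  If m + 1 = 2^a w, then C n + 1 = 3 (n + 1) / 2 for odd n, so
-- C^k m + 1 = 3^k 2^(a-k) w: the orbit is odd for k < a, and C^a m + 1 = 3^a w is odd.
module Submission where

open import Defs
open import Data.Nat using (ℕ; zero; suc; NonZero; ≢-nonZero; ≢-nonZero⁻¹; >-nonZero; _+_; _*_; _^_; _%_; _/_; _<_; _≤_; _≥_; z≤n; s≤s)
open import Data.Nat.Properties
  using ( suc-injective; *-assoc; *-comm; *-suc; +-comm; +-identityʳ; +-mono-≤; ≤-trans; m≤m*n
        ; m^n>0; ^-distribˡ-+-*; m≤n⇒∃[o]m+o≡n; *-commutativeSemigroup; m*n≢0; m^n≢0; 1+n≢0)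
open import Data.Nat.DivMod using (m*n%n≡0; m*n/n≡m; m≡m%n+[m/n]*n; %-distribˡ-*; m/n<m)
open import Algebra.Properties.CommutativeSemigroup *-commutativeSemigroup using (xy∙z≈y∙xz; x∙yz≈y∙xz)
open import Data.Nat.Induction using (<-rec)
open import Data.Nat.Tactic.RingSolver using (solve-∀)
open import Data.Product using (_×_; _,_; ∃; ∃₂)
open import Data.Sum using (_⊎_; inj₁; inj₂)
open import Relation.Binary.PropositionalEquality
  using (_≡_; _≢_; refl; sym; trans; cong; cong₂; subst; module ≡-Reasoning)

n%2≡0⊎n%2≡1 : ∀ n → n % 2 ≡ 0 ⊎ n % 2 ≡ 1
n%2≡0⊎n%2≡1 zero          = inj₁ refl
n%2≡0⊎n%2≡1 (suc zero)    = inj₂ refl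
n%2≡0⊎n%2≡1 (suc (suc n)) = n%2≡0⊎n%2≡1 n

n%2≡0⇒[1+n]%2≡1 : ∀ n → n % 2 ≡ 0 → suc n % 2 ≡ 1
n%2≡0⇒[1+n]%2≡1 zero          _ = refl
n%2≡0⇒[1+n]%2≡1 (suc zero)    ()
n%2≡0⇒[1+n]%2≡1 (suc (suc n)) h = n%2≡0⇒[1+n]%2≡1 n h

[1+n]%2≡0⇒n%2≡1 : ∀ n → suc n % 2 ≡ 0 → n % 2 ≡ 1
[1+n]%2≡0⇒n%2≡1 zero          ()
[1+n]%2≡0⇒n%2≡1 (suc zero)    _ = refl
[1+n]%2≡0⇒n%2≡1 (suc (suc n)) h = [1+n]%2≡0⇒n%2≡1 n h

[1+n]%2≡1⇒n%2≡0 : ∀ n → suc n % 2 ≡ 1 → n % 2 ≡ 0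
[1+n]%2≡1⇒n%2≡0 zero          _ = refl
[1+n]%2≡1⇒n%2≡0 (suc zero)    ()
[1+n]%2≡1⇒n%2≡0 (suc (suc n)) h = [1+n]%2≡1⇒n%2≡0 n h

[2*n]%2≡0 : ∀ n → (2 * n) % 2 ≡ 0
[2*n]%2≡0 n = trans (cong (_% 2) (*-comm 2 n)) (m*n%n≡0 n 2)

[2*n]/2≡n : ∀ n → (2 * n) / 2 ≡ n
[2*n]/2≡n n = trans (cong (_/ 2) (*-comm 2 n)) (m*n/n≡m n 2)

n%2≡0⇒n≡2*[n/2] : ∀ {n} → n % 2 ≡ 0 → n ≡ 2 * (n / 2)
n%2≡0⇒n≡2*[n/2] {n} h = trans (m≡m%n+[m/n]*n n 2) (trans (cong (_+ (n / 2) * 2) h) (*-comm (n / 2) 2))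

%2-odd-* : ∀ m n → m % 2 ≡ 1 → n % 2 ≡ 1 → (m * n) % 2 ≡ 1
%2-odd-* m n hm hn = trans (%-distribˡ-* m n 2) (cong₂ (λ a b → (a * b) % 2) hm hn)

3^k%2≡1 : ∀ k → 3 ^ k % 2 ≡ 1
3^k%2≡1 zero    = refl
3^k%2≡1 (suc k) = %2-odd-* 3 (3 ^ k) refl (3^k%2≡1 k)

C-even : ∀ n → n % 2 ≡ 0 → C n ≡ n / 2
C-even n h rewrite h = refl

C-odd : ∀ n → n % 2 ≡ 1 → C n ≡ (3 * n + 1) / 2
C-odd n h rewrite h = refl

C[2*n]≡n : ∀ n → C (2 * n) ≡ n
C[2*n]≡n n = trans (C-even (2 * n) ([2*n]%2≡0 n)) ([2*n]/2≡n n)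

1+n≡2*x⇒1+C[n]≡3*x : ∀ {n x} → suc n ≡ 2 * x → suc (C n) ≡ 3 * x
1+n≡2*x⇒1+C[n]≡3*x {x = zero} ()
1+n≡2*x⇒1+C[n]≡3*x {n} {suc w} 1+n≡2x = begin
  suc (C n)                           ≡⟨ cong (λ t → suc (C t)) n≡1+2w ⟩
  suc (C (1 + 2 * w))                 ≡⟨ cong suc (C-odd (1 + 2 * w) (n%2≡0⇒[1+n]%2≡1 (2 * w) ([2*n]%2≡0 w))) ⟩
  suc ((3 * (1 + 2 * w) + 1) / 2)     ≡⟨ cong (λ t → suc (t / 2)) (3[1+2w]+1≡2[2+3w] w) ⟩
  suc ((2 * (2 + 3 * w)) / 2)         ≡⟨ cong suc ([2*n]/2≡n (2 + 3 * w)) ⟩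
  3 + 3 * w                           ≡⟨ sym (*-suc 3 w) ⟩
  3 * suc w                           ∎
  where
  open ≡-Reasoning
  n≡1+2w : n ≡ 1 + 2 * w
  n≡1+2w = suc-injective (trans 1+n≡2x (*-suc 2 w))
  3[1+2w]+1≡2[2+3w] : ∀ w → 3 * (1 + 2 * w) + 1 ≡ 2 * (2 + 3 * w)
  3[1+2w]+1≡2[2+3w] = solve-∀

iterC-k[2^k*x]≡x : ∀ k x → iterC k (2 ^ k * x) ≡ x
iterC-k[2^k*x]≡x zero    x = +-identityʳ x
iterC-k[2^k*x]≡x (suc k) x = begin
  C (iterC k (2 * 2 ^ k * x))  ≡⟨ cong (λ t → C (iterC k t)) (xy∙z≈y∙xz 2 (2 ^ k) x) ⟩
  C (iterC k (2 ^ k * (2 * x))) ≡⟨ cong C (iterC-k[2^k*x]≡x k (2 * x)) ⟩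
  C (2 * x)                     ≡⟨ C[2*n]≡n x ⟩
  x                             ∎
  where open ≡-Reasoning

1+n≡2^k*x⇒1+iterC[k,n]≡3^k*x : ∀ k x {n} → suc n ≡ 2 ^ k * x → suc (iterC k n) ≡ 3 ^ k * x
1+n≡2^k*x⇒1+iterC[k,n]≡3^k*x zero    x eq = eq
1+n≡2^k*x⇒1+iterC[k,n]≡3^k*x (suc k) x {n} eq =
  trans (1+n≡2*x⇒1+C[n]≡3*x {x = 3 ^ k * x} 1+iterC≡2*3^k*x) (sym (*-assoc 3 (3 ^ k) x))
  where
  1+iterC≡2*3^k*x : suc (iterC k n) ≡ 2 * (3 ^ k * x)
  1+iterC≡2*3^k*x = trans (1+n≡2^k*x⇒1+iterC[k,n]≡3^k*x k (2 * x) (trans eq (xy∙z≈y∙xz 2 (2 ^ k) x)))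
                          (x∙yz≈y∙xz (3 ^ k) 2 x)

k<a⇒2^a*u≡2^k*[2*v] : ∀ {k a} u → k < a → ∃ λ v → 2 ^ a * u ≡ 2 ^ k * (2 * v)
k<a⇒2^a*u≡2^k*[2*v] {k} u k<a with m≤n⇒∃[o]m+o≡n k<a
... | d , refl = 2 ^ d * u , 2^[1+k+d]*u≡2^k*[2*[2^d*u]]
  where
  regroup : ∀ p q u → 2 * (p * q) * u ≡ p * (2 * (q * u))
  regroup = solve-∀
  2^[1+k+d]*u≡2^k*[2*[2^d*u]] : 2 ^ suc (k + d) * u ≡ 2 ^ k * (2 * (2 ^ d * u))
  2^[1+k+d]*u≡2^k*[2*[2^d*u]] = trans (cong (λ t → 2 * t * u) (^-distribˡ-+-* 2 k d)) (regroup (2 ^ k) (2 ^ d) u)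


even-orbit : ∀ {n a u} → n ≡ 2 ^ a * u → u % 2 ≡ 1 →
  (∀ k → k < a → iterC k n % 2 ≡ 0) × iterC a n % 2 ≡ 1
even-orbit {a = a} {u} refl u%2≡1 = before , trans (cong (_% 2) (iterC-k[2^k*x]≡x a u)) u%2≡1
  where
  before : ∀ k → k < a → iterC k (2 ^ a * u) % 2 ≡ 0
  before k k<a with k<a⇒2^a*u≡2^k*[2*v] u k<a
  ... | v , eq = trans (cong (λ t → iterC k t % 2) eq)
                       (trans (cong (_% 2) (iterC-k[2^k*x]≡x k (2 * v))) ([2*n]%2≡0 v))

odd-orbit : ∀ {n a w} → suc n ≡ 2 ^ a * w → w % 2 ≡ 1 →
  (∀ k → k < a → iterC k n % 2 ≡ 1) × iterC a n % 2 ≡ 0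
odd-orbit {n} {a} {w} 1+n≡2^a*w w%2≡1 = before , [1+n]%2≡1⇒n%2≡0 (iterC a n) 1+iterC[a,n]%2≡1
  where
  1+iterC[a,n]%2≡1 : suc (iterC a n) % 2 ≡ 1
  1+iterC[a,n]%2≡1 = trans (cong (_% 2) (1+n≡2^k*x⇒1+iterC[k,n]≡3^k*x a w 1+n≡2^a*w))
                           (%2-odd-* (3 ^ a) w (3^k%2≡1 a) w%2≡1)
  before : ∀ k → k < a → iterC k n % 2 ≡ 1
  before k k<a with k<a⇒2^a*u≡2^k*[2*v] w k<a
  ... | v , eq = [1+n]%2≡0⇒n%2≡1 (iterC k n) (begin
    suc (iterC k n) % 2    ≡⟨ cong (_% 2) (1+n≡2^k*x⇒1+iterC[k,n]≡3^k*x k (2 * v) (trans 1+n≡2^a*w eq)) ⟩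
    (3 ^ k * (2 * v)) % 2  ≡⟨ cong (_% 2) (x∙yz≈y∙xz (3 ^ k) 2 v) ⟩
    (2 * (3 ^ k * v)) % 2  ≡⟨ [2*n]%2≡0 (3 ^ k * v) ⟩
    0                      ∎)
    where open ≡-Reasoning

ν₂-fuel-odd : ∀ f n → n % 2 ≡ 1 → ν₂-fuel (suc f) n ≡ 0
ν₂-fuel-odd f (suc n) h rewrite h = refl

ν₂-fuel-double : ∀ f n → .{{NonZero n}} → ν₂-fuel (suc f) (2 * n) ≡ suc (ν₂-fuel f n)
ν₂-fuel-double f n@(suc _) rewrite [2*n]%2≡0 n | [2*n]/2≡n n = refl

ν₂-fuel[2^a*u]≡a : ∀ {f} a u → a < f → u % 2 ≡ 1 → ν₂-fuel f (2 ^ a * u) ≡ a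
ν₂-fuel[2^a*u]≡a {suc f} zero    u _ u%2≡1 rewrite +-identityʳ u = ν₂-fuel-odd f u u%2≡1
ν₂-fuel[2^a*u]≡a {suc f} (suc a) u@(suc _) (s≤s a<f) u%2≡1 = begin
  ν₂-fuel (suc f) (2 * 2 ^ a * u)    ≡⟨ cong (ν₂-fuel (suc f)) (*-assoc 2 (2 ^ a) u) ⟩
  ν₂-fuel (suc f) (2 * (2 ^ a * u))  ≡⟨ ν₂-fuel-double f (2 ^ a * u) {{m*n≢0 (2 ^ a) u {{m^n≢0 2 a}}}} ⟩
  suc (ν₂-fuel f (2 ^ a * u))        ≡⟨ cong suc (ν₂-fuel[2^a*u]≡a a u a<f u%2≡1) ⟩
  suc a                              ∎
  where open ≡-Reasoning

n<2^n : ∀ n → n < 2 ^ n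
n<2^n zero    = s≤s z≤n
n<2^n (suc n) = subst (suc (suc n) ≤_) (cong (2 ^ n +_) (sym (+-identityʳ (2 ^ n))))
                      (+-mono-≤ (m^n>0 2 n) (n<2^n n))

ν₂[2^a*u]≡a : ∀ a u → u % 2 ≡ 1 → ν₂ (2 ^ a * u) ≡ a
ν₂[2^a*u]≡a a u@(suc _) u%2≡1 =
  ν₂-fuel[2^a*u]≡a a u (≤-trans (n<2^n a) (m≤m*n (2 ^ a) u)) u%2≡1

n≡2^a*odd : ∀ n → .{{NonZero n}} → ∃₂ λ a u → u % 2 ≡ 1 × n ≡ 2 ^ a * u
n≡2^a*odd n = <-rec Decomposable decompose n
  where
  Decomposable : ℕ → Set
  Decomposable n = .{{NonZero n}} → ∃₂ λ a u → u % 2 ≡ 1 × n ≡ 2 ^ a * u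
  decompose : ∀ n → (∀ {m} → m < n → Decomposable m) → Decomposable n
  decompose n rec with n%2≡0⊎n%2≡1 n
  ... | inj₂ n%2≡1 = 0 , n , n%2≡1 , sym (+-identityʳ n)
  ... | inj₁ n%2≡0 =
    let a , u , u%2≡1 , n/2≡2^a*u = rec (m/n<m n 2 (s≤s (s≤s z≤n))) {{≢-nonZero n/2≢0}}
    in suc a , u , u%2≡1 , trans n≡2*[n/2] (trans (cong (2 *_) n/2≡2^a*u) (sym (*-assoc 2 (2 ^ a) u)))
    where
    n≡2*[n/2] : n ≡ 2 * (n / 2)
    n≡2*[n/2] = n%2≡0⇒n≡2*[n/2] n%2≡0
    n/2≢0 : n / 2 ≢ 0
    n/2≢0 n/2≡0 = ≢-nonZero⁻¹ n (trans n≡2*[n/2] (cong (2 *_) n/2≡0))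

ν₂[n*v]≡a : ∀ {n} a u v → n ≡ 2 ^ a * u → u % 2 ≡ 1 → v % 2 ≡ 1 → ν₂ (n * v) ≡ a
ν₂[n*v]≡a a u v refl u%2≡1 v%2≡1 =
  trans (cong ν₂ (*-assoc (2 ^ a) u v)) (ν₂[2^a*u]≡a a (u * v) (%2-odd-* u v u%2≡1 v%2≡1))

theorem6p1 : ∀ (m : ℕ) → m ≥ 1 →
    (∀ (k : ℕ) → k < ν₂ (m * (m + 1)) → iterC k m % 2 ≡ m % 2)
    × (iterC (ν₂ (m * (m + 1))) m % 2 ≢ m % 2)
theorem6p1 m m≥1 with n%2≡0⊎n%2≡1 m
... | inj₁ m%2≡0
  with a , u , u%2≡1 , m≡2^a*u ← n≡2^a*odd m {{>-nonZero m≥1}}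
  rewrite +-comm m 1 | ν₂[n*v]≡a a u (suc m) m≡2^a*u u%2≡1 (n%2≡0⇒[1+n]%2≡1 m m%2≡0) | m%2≡0
  = let before , at = even-orbit m≡2^a*u u%2≡1 in before , λ at≡0 → 1+n≢0 (trans (sym at) at≡0)
... | inj₂ m%2≡1
  with a , w , w%2≡1 , 1+m≡2^a*w ← n≡2^a*odd (suc m)
  rewrite +-comm m 1 | *-comm m (suc m) | ν₂[n*v]≡a a w m 1+m≡2^a*w w%2≡1 m%2≡1 | m%2≡1
  = let before , at = odd-orbit 1+m≡2^a*w w%2≡1 in before , λ at≡1 → 1+n≢0 (trans (sym at≡1) at)
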